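{- Let $(\mathbb{A},\mathcal{A})$ and $(\mathbb{B},\mathcal{B})$ be Boolean kits and $P:(\mathbb{A},\mathcal{A})\to(\mathbb{B},\mathcal{B})$ a stabilized profunctor. Then the profunctor $\mathrm{Sym}\,P:\mathrm{Sym}\,\mathbb{A}\to\mathrm{Sym}\,\mathbb{B}$ is a stabilized profunctor $!(\mathbb{A},\mathcal{A})\to!(\mathbb{B},\mathcal{B})$.
   Context: A kit on a groupoid $\mathbb{A}$ is a family $\mathcal{A}(a)$ of sets of subgroups of $\mathrm{End}(a)=\mathbb{A}(a,a)$ closed under conjugation; subgroups are orthogonal if they intersect in $\{\mathrm{id}\}$; $\mathcal{K}^\perp(a)$ is the set of subgroups orthogonal to all members of $\mathcal{K}(a)$; a kit is Boolean if $\mathcal{A}=\mathcal{A}^{\perp\perp}$; $\bigcup\mathcal{A}(a)$ is the union of members. A stabilized profunctor $(\mathbb{A},\mathcal{A})\to(\mathbb{B},\mathcal{B})$ is a functor $P:\mathbb{B}^{op}\times\mathbb{A}\to\mathbf{Set}$ such that whenever $\alpha\cdot p\cdot\beta=p$ ($p\in P(b,a)$, $\alpha\in\mathrm{End}(a)$, $\beta\in\mathrm{End}(b)$): $\alpha\in\bigcup\mathcal{A}(a)\Rightarrow\beta\in\bigcup\mathcal{B}(b)$ and $\beta\in\bigcup\mathcal{B}^\perp(b)\Rightarrow\alpha\in\bigcup\mathcal{A}^\perp(a)$. $\mathrm{Sym}\,\mathbb{A}$ has objects finite sequences $\langle a_1,\dots,a_n\rangle$ and morphisms $(\sigma,(\alpha_i:a_i\to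 b_{\sigma(i)}))$, $\sigma\in S_n$. For $\alpha=(\sigma,(\alpha_i))\in\mathrm{End}(\langle a_1,\ldots,a_n\rangle)$, $\langle\alpha\rangle_i=\alpha_{\sigma^{o(i)-1}(i)}\circ\cdots\circ\alpha_i$ with $o(i)$ the least $k>0$ with $\sigma^k(i)=i$; $\mathcal{A}^{\mathrm{Sym}}(u)$ is the set of subgroups $H\le\mathrm{End}(u)$ with $\langle\alpha\rangle_i\in\bigcup\mathcal{A}(a_i)$ for all $\alpha\in H$, $i$; $!(\mathbb{A},\mathcal{A})=(\mathrm{Sym}\,\mathbb{A},(\mathcal{A}^{\mathrm{Sym}})^{\perp\perp})$. $\mathrm{Sym}\,P(\langle b_j\rangle_{j\le m},\langle a_i\rangle_{i\le n})=\coprod_{\varphi\in S_n}\prod_{j}P(b_j,a_{\varphi(j)})$ if $n=m$ and $\emptyset$ otherwise, with action $(\sigma,(\alpha_i))\cdot(\varphi,(p_j))\cdot(\tau,(\beta_j))=(\sigma\circ\varphi\circ\tau,(\alpha_{\varphi(\tau(j))}\cdot p_{\tau(j)}\cdot\beta_j)_j)$. -}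

module Defs where

open import Level using (Level; suc; _⊔_) renaming (zero to lzero)
open import Data.Nat.Base using (ℕ; zero; suc; _<_)
open import Data.Fin.Base using (Fin)
open import Data.Vec.Base using (Vec; lookup)
open import Data.Product.Base using (Σ; Σ-syntax; _×_; _,_; proj₁; proj₂)
open import Data.Fin.Permutation using (Permutation; Permutation′; _⟨$⟩ʳ_; _∘ₚ_)
  renaming (id to idₚ)
open import Function.Bundles using (_⇔_)
open import Relation.Binary.PropositionalEquality using (_≡_; _≢_; subst)

-- Only used to state
-- the kit notions uniformly for a groupoid 𝔸 (whose equality is ≡) and
-- for Sym 𝔸 (whose morphisms are compared pointwise).

record RawGpd : Set₁ where
  infixr 9 _∘_
  infix 4 _≈_
  field
    Obj : Set
    Hom : Obj → Obj → Set
    _≈_ : ∀ {a b} → Hom a b → Hom a b → Set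
    id  : ∀ {a} → Hom a a
    _∘_ : ∀ {a b c} → Hom b c → Hom a b → Hom a c

  End : Obj → Set
  End a = Hom a a

record Groupoid : Set₁ where
  infixr 9 _∘_
  field
    Obj : Set
    Hom : Obj → Obj → Set
    id  : ∀ {a} → Hom a a
    _∘_ : ∀ {a b c} → Hom b c → Hom a b → Hom a c
    inv : ∀ {a b} → Hom a b → Hom b a
    assoc : ∀ {a b c d} (f : Hom c d) (g : Hom b c) (h : Hom a b) →
            (f ∘ g) ∘ h ≡ f ∘ (g ∘ h)
    identityˡ : ∀ {a b} (f : Hom a b) → id ∘ f ≡ f
    identityʳ : ∀ {a b} (f : Hom a b) → f ∘ id ≡ f
    inverseˡ : ∀ {a b} (f : Hom a b) → inv f ∘ f ≡ id
    inverseʳ : ∀ {a b} (f : Hom a b) → f ∘ inv f ≡ id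

  End : Obj → Set
  End a = Hom a a

  raw : RawGpd
  raw = record { Obj = Obj ; Hom = Hom ; _≈_ = _≡_ ; id = id ; _∘_ = _∘_ }

module KitNotions (G : RawGpd) where
  open RawGpd G

  record Subgroup (a : Obj) : Set₁ where
    field
      mem   : End a → Set
      resp  : ∀ {f g} → f ≈ g → mem f → mem g
      id∈   : mem id
      ∘∈    : ∀ {f g} → mem f → mem g → mem (f ∘ g)
      inv∈  : ∀ {f} → mem f → Σ (End a) λ g → mem g × (g ∘ f ≈ id) × (f ∘ g ≈ id)
  open Subgroup public

  SubgroupFamily : Set₂
  SubgroupFamily = (a : Obj) → Subgroup a → Set₁

  Orthogonal : ∀ {a} → Subgroup a → Subgroup a → Set
  Orthogonal H K = ∀ f → mem H f → mem K f → f ≈ id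

  _^⊥ : SubgroupFamily → SubgroupFamily
  (𝒦 ^⊥) a H = ∀ K → 𝒦 a K → Orthogonal H K

  ⋃ : SubgroupFamily → (a : Obj) → End a → Set₁
  ⋃ 𝒦 a f = Σ (Subgroup a) λ H → 𝒦 a H × mem H f

module _ (𝔸 : Groupoid) where
  open Groupoid 𝔸
  open KitNotions raw

  -- 𝒜 is closed under conjugation: if H ∈ 𝒜(a) and f : a → a', then
  -- f H f⁻¹ ∈ 𝒜(a')  (K below is any subgroup with exactly the
  -- elements of f H f⁻¹, so 𝒜 is in particular a set of subgroups,
  -- i.e. invariant under having the same elements)
  record IsKit (𝒜 : SubgroupFamily) : Set₁ where
    field
      conj-closed : ∀ {a a'} (f : Hom a a') (H : Subgroup a) (K : Subgroup a') →
                    (∀ g → mem K g ⇔ mem H (inv f ∘ (g ∘ f))) →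
                    𝒜 a H → 𝒜 a' K

  record IsBooleanKit (𝒜 : SubgroupFamily) : Set₁ where
    field
      isKit   : IsKit 𝒜
      boolean : ∀ a (H : Subgroup a) → 𝒜 a H ⇔ ((𝒜 ^⊥) ^⊥) a H

record RawProf (A B : RawGpd) : Set₁ where
  private
    module A = RawGpd A
    module B = RawGpd B
  infix 4 _≈_
  field
    F   : B.Obj → A.Obj → Set
    _≈_ : ∀ {b a} → F b a → F b a → Set
    _▷_ : ∀ {b a a'} → A.Hom a a' → F b a → F b a'
    _◁_ : ∀ {b b' a} → F b a → B.Hom b' b → F b' a

record Profunctor (𝔸 𝔹 : Groupoid) : Set₁ where
  private
    module A = Groupoid 𝔸
    module B = Groupoid 𝔹
  field
    F   : B.Obj → A.Obj → Set
    _▷_ : ∀ {b a a'} → A.Hom a a' → F b a → F b a'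
    _◁_ : ∀ {b b' a} → F b a → B.Hom b' b → F b' a
    ▷-id : ∀ {b a} (p : F b a) → A.id ▷ p ≡ p
    ▷-∘  : ∀ {b a a' a''} (f : A.Hom a' a'') (g : A.Hom a a') (p : F b a) →
           (f A.∘ g) ▷ p ≡ f ▷ (g ▷ p)
    ◁-id : ∀ {b a} (p : F b a) → p ◁ B.id ≡ p
    ◁-∘  : ∀ {b b' b'' a} (p : F b a) (f : B.Hom b' b) (g : B.Hom b'' b') →
           p ◁ (f B.∘ g) ≡ (p ◁ f) ◁ g
    ▷◁   : ∀ {b b' a a'} (f : A.Hom a a') (p : F b a) (g : B.Hom b' b) →
           (f ▷ p) ◁ g ≡ f ▷ (p ◁ g)

  raw : RawProf (Groupoid.raw 𝔸) (Groupoid.raw 𝔹)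
  raw = record { F = F ; _≈_ = _≡_ ; _▷_ = _▷_ ; _◁_ = _◁_ }

IsStabilized : (A B : RawGpd) →
               KitNotions.SubgroupFamily A → KitNotions.SubgroupFamily B →
               RawProf A B → Set₁
IsStabilized A B 𝒜 ℬ P =
  ∀ {a b} (p : F b a) (α : RawGpd.End A a) (β : RawGpd.End B b) →
  ((α ▷ p) ◁ β) ≈ p →
  (KA.⋃ 𝒜 a α → KB.⋃ ℬ b β) × (KB.⋃ (ℬ KB.^⊥) b β → KA.⋃ (𝒜 KA.^⊥) a α)
  where
    open RawProf P
    module KA = KitNotions A
    module KB = KitNotions B

-- Sym 𝔸: objects are finite sequences ⟨a₁,…,aₙ⟩, morphisms are
-- (σ, (αᵢ : aᵢ → b_{σ(i)})) with σ a bijection Fin n ↔ Fin m (such a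
-- bijection exists only when n = m).

module _ (𝔸 : Groupoid) where
  private module A = Groupoid 𝔸

  SymObj : Set
  SymObj = Σ ℕ (Vec A.Obj)

  SymHom : SymObj → SymObj → Set
  SymHom (n , as) (m , bs) =
    Σ (Permutation n m) λ σ → (i : Fin n) → A.Hom (lookup as i) (lookup bs (σ ⟨$⟩ʳ i))

  Sym : RawGpd
  Sym = record
    { Obj = SymObj
    ; Hom = SymHom
    ; _≈_ = λ {(n , as)} {(m , bs)} f g → (i : Fin n) →
            _≡_ {A = Σ (Fin m) λ k → A.Hom (lookup as i) (lookup bs k)}
                (proj₁ f ⟨$⟩ʳ i , proj₂ f i) (proj₁ g ⟨$⟩ʳ i , proj₂ g i)
    ; id  = idₚ , λ i → A.id
    ; _∘_ = λ (σ , α) (τ , β) → (τ ∘ₚ σ) , λ i → α (τ ⟨$⟩ʳ i) A.∘ β i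
    }

  _^[_]_ : ∀ {n} → Permutation′ n → ℕ → Fin n → Fin n
  σ ^[ zero ] i = i
  σ ^[ suc k ] i = σ ⟨$⟩ʳ (σ ^[ k ] i)

  IsOrbitLength : ∀ {n} → Permutation′ n → Fin n → ℕ → Set
  IsOrbitLength σ i k =
    (0 < k) × (σ ^[ k ] i ≡ i) × (∀ l → 0 < l → l < k → σ ^[ l ] i ≢ i)

  walk : ∀ {n} {as : Vec A.Obj n} (α : SymHom (n , as) (n , as)) (k : ℕ) (i : Fin n) →
         A.Hom (lookup as i) (lookup as (proj₁ α ^[ k ] i))
  walk α zero i = A.id
  walk {as = as} α (suc k) i = proj₂ α (proj₁ α ^[ k ] i) A.∘ walk {as = as} α k i

  cycleEnd : ∀ {n} {as : Vec A.Obj n} (α : SymHom (n , as) (n , as)) (i : Fin n) (k : ℕ) →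
             proj₁ α ^[ k ] i ≡ i → A.End (lookup as i)
  cycleEnd {as = as} α i k e =
    subst (λ x → A.Hom (lookup as i) (lookup as x)) e (walk {as = as} α k i)

  private
    module KA = KitNotions A.raw
    module KS = KitNotions Sym

  _^Sym : KA.SubgroupFamily → KS.SubgroupFamily
  (𝒜 ^Sym) (n , as) H =
    ∀ α → KS.mem H α → ∀ (i : Fin n) (k : ℕ) (o : IsOrbitLength (proj₁ α) i k) →
    KA.⋃ 𝒜 (lookup as i) (cycleEnd {as = as} α i k (proj₁ (proj₂ o)))

  !kit : KA.SubgroupFamily → KS.SubgroupFamily
  !kit 𝒜 = ((𝒜 ^Sym) KS.^⊥) KS.^⊥

module _ {𝔸 𝔹 : Groupoid} (P : Profunctor 𝔸 𝔹) where
  private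
    module A = Groupoid 𝔸
    module B = Groupoid 𝔹
    module P = Profunctor P

  SymF : SymObj 𝔹 → SymObj 𝔸 → Set
  SymF (m , bs) (n , as) =
    Σ (Permutation m n) λ φ → (j : Fin m) → P.F (lookup bs j) (lookup as (φ ⟨$⟩ʳ j))

  SymP : RawProf (Sym 𝔸) (Sym 𝔹)
  SymP = record
    { F = SymF
    ; _≈_ = λ {(m , bs)} {(n , as)} x y → (j : Fin m) →
            _≡_ {A = Σ (Fin n) λ k → P.F (lookup bs j) (lookup as k)}
                (proj₁ x ⟨$⟩ʳ j , proj₂ x j) (proj₁ y ⟨$⟩ʳ j , proj₂ y j)
    ; _▷_ = λ (σ , α) (φ , p) → (φ ∘ₚ σ) , λ j → α (φ ⟨$⟩ʳ j) P.▷ p j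
    ; _◁_ = λ (φ , p) (τ , β) → (τ ∘ₚ φ) , λ j → p (τ ⟨$⟩ʳ j) P.◁ β j
    }

-- Fix p = (φ, (p_j)) in Sym P(v, u).  The pairs (α, β) with α · p · β = p are closed under
-- composition and inverses, so a subgroup H ≤ End u pushes forward to the subgroup
-- push p H = {β | ∃ α ∈ H. α · p · β = p} of End v, and dually K ≤ End v pulls back to pull p K.
-- Iterating α · p · β = p along an orbit of β of length k shows that φ maps it onto an orbit
-- of α of the same length and that the cycle products satisfy ⟨α⟩_{φ(j)} · p_j · ⟨β⟩_j = p_j.
-- Stabilization of P then gives push p (𝒜^Sym) ⊆ ℬ^Sym and pull p ((ℬ^Sym)^⊥) ⊆ (𝒜^Sym)^⊥, and
-- these lift to push p (!𝒜) ⊆ !ℬ and pull p (!ℬ^⊥) ⊆ !𝒜^⊥ once the trivial subgroup is known to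
-- lie in 𝒜^Sym, which holds because 𝒜 is Boolean.  Finally α ∈ H ∈ !𝒜
-- gives β ∈ push p H ∈ !ℬ, and β ∈ K ∈ !ℬ^⊥ gives α ∈ pull p K ∈ !𝒜^⊥.

module Submission where

open import Defs
open import Data.Nat.Base using (ℕ; zero; suc; _<_; s≤s; z≤n)
open import Data.Fin.Base using (Fin)
open import Data.Fin.Properties using (_≟_)
open import Data.Vec.Base using (Vec; lookup)
open import Data.Product.Base using (Σ; _×_; _,_; proj₁; proj₂)
open import Data.Product.Properties using (,-injectiveʳ-UIP; Σ-≡,≡→≡)
open import Data.Fin.Permutation using (Permutation; Permutation′; _⟨$⟩ʳ_; _⟨$⟩ˡ_; flip)
  renaming (id to idₚ; inverseˡ to ⟨$⟩ˡ∘⟨$⟩ʳ; inverseʳ to ⟨$⟩ʳ∘⟨$⟩ˡ)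
open import Function.Base using (_∋_; _$_)
open import Function.Bundles using (Equivalence; Injection)
open import Function.Properties.Inverse using (↔⇒↣)
open import Relation.Binary.Bundles using (Setoid)
open import Relation.Binary.Structures using (IsEquivalence)
open import Relation.Binary.PropositionalEquality
open import Axiom.UniquenessOfIdentityProofs using (module Decidable⇒UIP)
import Relation.Binary.Reasoning.Setoid as SetoidReasoning

Fin-≡-irrelevant : ∀ {n} {i j : Fin n} (p q : i ≡ j) → p ≡ q
Fin-≡-irrelevant = Decidable⇒UIP.≡-irrelevant _≟_

,-injectiveʳ-Fin : ∀ {n} {B : Fin n → Set} {i} {b c : B i} →
                   (Σ (Fin n) B ∋ (i , b)) ≡ (i , c) → b ≡ c
,-injectiveʳ-Fin = ,-injectiveʳ-UIP Fin-≡-irrelevant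

,-subst : ∀ {n} (B : Fin n → Set) {i j} (e : i ≡ j) (b : B i) →
          (Σ (Fin n) B ∋ (i , b)) ≡ (j , subst B e b)
,-subst B e b = Σ-≡,≡→≡ (e , refl)

⟨$⟩ʳ-injective : ∀ {m n} (π : Permutation m n) {i j} → π ⟨$⟩ʳ i ≡ π ⟨$⟩ʳ j → i ≡ j
⟨$⟩ʳ-injective π = Injection.injective (↔⇒↣ π)

^[]-injective : ∀ (𝔸 : Groupoid) {n} (σ : Permutation′ n) t {i j} →
                _^[_]_ 𝔸 σ t i ≡ _^[_]_ 𝔸 σ t j → i ≡ j
^[]-injective 𝔸 σ zero    e = e
^[]-injective 𝔸 σ (suc t) e = ^[]-injective 𝔸 σ t (⟨$⟩ʳ-injective σ e)

module KitProperties (G : RawGpd) where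
  open RawGpd G
  open KitNotions G

  ⊆^⊥⊥ : ∀ 𝒦 {a} {H : Subgroup a} → 𝒦 a H → ((𝒦 ^⊥) ^⊥) a H
  ⊆^⊥⊥ 𝒦 H∈𝒦 K K∈𝒦⊥ f f∈H f∈K = K∈𝒦⊥ _ H∈𝒦 f f∈K f∈H

  ^⊥⊥⊥⇒^⊥ : ∀ 𝒦 {a} {H : Subgroup a} → (((𝒦 ^⊥) ^⊥) ^⊥) a H → (𝒦 ^⊥) a H
  ^⊥⊥⊥⇒^⊥ 𝒦 H∈𝒦⊥⊥⊥ K K∈𝒦 = H∈𝒦⊥⊥⊥ K (⊆^⊥⊥ 𝒦 K∈𝒦)

  ⋃-⋃^⊥⇒≈id : ∀ 𝒦 {a} {f : End a} → ⋃ 𝒦 a f → ⋃ (𝒦 ^⊥) a f → f ≈ id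
  ⋃-⋃^⊥⇒≈id 𝒦 (H , H∈𝒦 , f∈H) (K , K∈𝒦⊥ , f∈K) = K∈𝒦⊥ H H∈𝒦 _ f∈K f∈H

  module Trivial {a : Obj} (≈-isEquivalence : IsEquivalence (_≈_ {a} {a}))
                 (∘-cong : ∀ {f f′ g g′ : End a} → f ≈ f′ → g ≈ g′ → f ∘ g ≈ f′ ∘ g′)
                 (id∘id : _∘_ {a} id id ≈ id) where
    open IsEquivalence ≈-isEquivalence renaming (refl to ≈-refl; sym to ≈-sym; trans to ≈-trans)

    trivial : Subgroup a
    trivial = record
      { mem  = _≈ id
      ; resp = λ f≈g f≈id → ≈-trans (≈-sym f≈g) f≈id
      ; id∈  = ≈-refl
      ; ∘∈   = λ f≈id g≈id → ≈-trans (∘-cong f≈id g≈id) id∘id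
      ; inv∈ = λ f≈id → id , ≈-refl , ≈-trans (∘-cong ≈-refl f≈id) id∘id
                              , ≈-trans (∘-cong f≈id ≈-refl) id∘id
      }

    trivial∈^⊥ : ∀ 𝒦 → (𝒦 ^⊥) a trivial
    trivial∈^⊥ 𝒦 K K∈𝒦 f f≈id f∈K = f≈id

    ≈id⇒∈⋃^⊥ : ∀ 𝒦 {f} → f ≈ id → ⋃ (𝒦 ^⊥) a f
    ≈id⇒∈⋃^⊥ 𝒦 f≈id = trivial , trivial∈^⊥ 𝒦 , f≈id

module GroupoidKit (𝔸 : Groupoid) {a : Groupoid.Obj 𝔸} where
  open Groupoid 𝔸
  open KitNotions raw
  open KitProperties raw
  open Trivial {a} isEquivalence (cong₂ _∘_) (identityˡ id) public

  id∈⋃-boolean : ∀ {𝒜} → IsBooleanKit 𝔸 𝒜 → ⋃ 𝒜 a id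
  id∈⋃-boolean {𝒜} 𝒜-boolean =
    trivial , Equivalence.from (IsBooleanKit.boolean 𝒜-boolean a trivial) (trivial∈^⊥ (𝒜 ^⊥)) , refl

module SymEnd (𝔸 : Groupoid) {n : ℕ} (as : Vec (Groupoid.Obj 𝔸) n) where
  open Groupoid 𝔸 hiding (End)

  HomFrom : Fin n → Set
  HomFrom i = Σ (Fin n) λ k → Hom (lookup as i) (lookup as k)

  End : Set
  End = SymHom 𝔸 (n , as) (n , as)

  infix 4 _≋_
  _≋_ : End → End → Set
  _≋_ = RawGpd._≈_ (Sym 𝔸) {n , as} {n , as}

  infixr 9 _∙_
  _∙_ : End → End → End
  _∙_ = RawGpd._∘_ (Sym 𝔸) {n , as} {n , as} {n , as}

  ε : End
  ε = RawGpd.id (Sym 𝔸) {n , as}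

  ≋-isEquivalence : IsEquivalence _≋_
  ≋-isEquivalence = record
    { refl  = λ _ → refl
    ; sym   = λ e i → sym (e i)
    ; trans = λ e e′ i → trans (e i) (e′ i)
    }

  ∙-cong : ∀ {α α′ β β′} → α ≋ α′ → β ≋ β′ → α ∙ β ≋ α′ ∙ β′
  ∙-cong {σ , a} {_ , a′} {_ , b} {τ′ , b′} α≋α′ β≋β′ i =
    trans (cong (λ (k , h) → σ ⟨$⟩ʳ k , a k ∘ h) (β≋β′ i))
          (cong (λ (k , h) → k , h ∘ b′ i) (α≋α′ (τ′ ⟨$⟩ʳ i)))

  ε∙ε≋ε : ε ∙ ε ≋ ε
  ε∙ε≋ε i = cong (i ,_) (identityˡ id)

  infix 10 _⁻¹
  _⁻¹ : End → End
  (σ , a) ⁻¹ = flip σ , λ i →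
    subst (λ k → Hom (lookup as k) (lookup as (σ ⟨$⟩ˡ i))) (⟨$⟩ʳ∘⟨$⟩ˡ σ) (inv (a (σ ⟨$⟩ˡ i)))

  ⁻¹∙≋ε : ∀ α → α ⁻¹ ∙ α ≋ ε
  ⁻¹∙≋ε (σ , a) i = cancel (⟨$⟩ˡ∘⟨$⟩ʳ σ) (⟨$⟩ʳ∘⟨$⟩ˡ σ)
    where
      cancel : ∀ {i′} (e : i′ ≡ i) (e′ : σ ⟨$⟩ʳ i′ ≡ σ ⟨$⟩ʳ i) →
               (HomFrom i ∋ (i′ , subst (λ k → Hom (lookup as k) (lookup as i′)) e′ (inv (a i′)) ∘ a i))
               ≡ (i , id)
      cancel refl e′ rewrite Fin-≡-irrelevant e′ refl = cong (i ,_) (inverseˡ (a i))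

  ∙⁻¹≋ε : ∀ α → α ∙ α ⁻¹ ≋ ε
  ∙⁻¹≋ε (σ , a) i = cancel (⟨$⟩ʳ∘⟨$⟩ˡ σ) (a (σ ⟨$⟩ˡ i))
    where
      cancel : ∀ {j k} (e : k ≡ i) (h : Hom (lookup as j) (lookup as k)) →
               (HomFrom i ∋ (k , h ∘ subst (λ l → Hom (lookup as l) (lookup as j)) e (inv h)))
               ≡ (i , id)
      cancel refl h = cong (i ,_) (inverseʳ h)

  walk-suc-shift : ∀ α t i →
    (HomFrom i ∋ (_^[_]_ 𝔸 (proj₁ α) (suc t) i , walk 𝔸 {as = as} α (suc t) i))
    ≡ (_^[_]_ 𝔸 (proj₁ α) t (proj₁ α ⟨$⟩ʳ i) , walk 𝔸 {as = as} α t (proj₁ α ⟨$⟩ʳ i) ∘ proj₂ α i)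
  walk-suc-shift (σ , a) zero i =
    cong (σ ⟨$⟩ʳ i ,_) (trans (identityʳ (a i)) (sym (identityˡ (a i))))
  walk-suc-shift (σ , a) (suc t) i =
    trans (cong (λ (k , h) → σ ⟨$⟩ʳ k , a k ∘ h) (walk-suc-shift (σ , a) t i))
          (cong (_ ,_) (sym (assoc _ _ _)))

  walk-ε : ∀ t i → (HomFrom i ∋ (_^[_]_ 𝔸 idₚ t i , walk 𝔸 {as = as} ε t i)) ≡ (i , id)
  walk-ε zero    i = refl
  walk-ε (suc t) i = trans (cong (λ (k , h) → k , id ∘ h) (walk-ε t i)) (cong (i ,_) (identityˡ id))

  cycleEnd-ε : ∀ i k (e : _^[_]_ 𝔸 idₚ k i ≡ i) → cycleEnd 𝔸 {as = as} ε i k e ≡ id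
  cycleEnd-ε i k e = ,-injectiveʳ-Fin (trans (sym (,-subst _ e _)) (walk-ε k i))

  cycleEnd-1 : ∀ α i (e : _^[_]_ 𝔸 (proj₁ α) 1 i ≡ i) →
               (HomFrom i ∋ (proj₁ α ⟨$⟩ʳ i , proj₂ α i)) ≡ (i , cycleEnd 𝔸 {as = as} α i 1 e)
  cycleEnd-1 α i e = trans (cong (_ ,_) (sym (identityʳ _))) (,-subst _ e _)

  ε-orbitLength : ∀ (i : Fin n) → IsOrbitLength 𝔸 idₚ i 1
  ε-orbitLength i = s≤s z≤n , refl , λ { (suc l) _ (s≤s ()) }

  CyclesIn : KitNotions.SubgroupFamily raw → End → Set₁
  CyclesIn 𝒜 α = ∀ i k (o : IsOrbitLength 𝔸 (proj₁ α) i k) →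
                 KitNotions.⋃ raw 𝒜 (lookup as i) (cycleEnd 𝔸 {as = as} α i k (proj₁ (proj₂ o)))

  open KitProperties (Sym 𝔸) using (module Trivial)
  open Trivial {n , as} ≋-isEquivalence (λ {α α′ β β′} → ∙-cong {α} {α′} {β} {β′}) ε∙ε≋ε public

module ProfunctorProperties {𝔸 𝔹 : Groupoid} (P : Profunctor 𝔸 𝔹) where
  open Profunctor P
  private
    module A = Groupoid 𝔸
    module B = Groupoid 𝔹

  ▷◁-id : ∀ {b a} (p : F b a) → (A.id ▷ p) ◁ B.id ≡ p
  ▷◁-id p = trans (cong (_◁ B.id) (▷-id p)) (◁-id p)

  ▷◁-∘ : ∀ {b b′ b″ a a′ a″} (f : A.Hom a′ a″) (f′ : A.Hom a a′) (p : F b a)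
           (g′ : B.Hom b′ b) (g : B.Hom b″ b′) →
         ((f A.∘ f′) ▷ p) ◁ (g′ B.∘ g) ≡ (f ▷ ((f′ ▷ p) ◁ g′)) ◁ g
  ▷◁-∘ f f′ p g′ g = begin
    ((f A.∘ f′) ▷ p) ◁ (g′ B.∘ g)   ≡⟨ ◁-∘ _ g′ g ⟩
    (((f A.∘ f′) ▷ p) ◁ g′) ◁ g     ≡⟨ cong (λ q → (q ◁ g′) ◁ g) (▷-∘ f f′ p) ⟩
    ((f ▷ (f′ ▷ p)) ◁ g′) ◁ g       ≡⟨ cong (_◁ g) (▷◁ f (f′ ▷ p) g′) ⟩
    (f ▷ ((f′ ▷ p) ◁ g′)) ◁ g       ∎
    where open ≡-Reasoning

module SymAction {𝔸 𝔹 : Groupoid} (P : Profunctor 𝔸 𝔹)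
                 {n : ℕ} (as : Vec (Groupoid.Obj 𝔸) n) {m : ℕ} (bs : Vec (Groupoid.Obj 𝔹) m) where
  private
    module P where
      open Profunctor P public
      open ProfunctorProperties P public
    module A = SymEnd 𝔸 as
    module B = SymEnd 𝔹 bs
    module KA = KitNotions (Sym 𝔸)
    module KB = KitNotions (Sym 𝔹)
    open Groupoid 𝔹 using () renaming (_∘_ to _∘𝔹_)

  Elem : Set
  Elem = SymF P (m , bs) (n , as)

  -- _≈_ and Stabilises are records rather than abbreviations, so that Agda can infer their
  -- indices from a proof.
  infix 4 _≈_
  record _≈_ (p q : Elem) : Set where
    constructor pointwise
    field at : RawProf._≈_ (SymP P) {m , bs} {n , as} p q
  open _≈_

  infixr 6 _▷_
  _▷_ : A.End → Elem → Elem
  _▷_ = RawProf._▷_ (SymP P) {m , bs} {n , as} {n , as}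

  infixl 7 _◁_
  _◁_ : Elem → B.End → Elem
  _◁_ = RawProf._◁_ (SymP P) {m , bs} {m , bs} {n , as}

  ≈-setoid : Setoid _ _
  ≈-setoid = record
    { Carrier = Elem
    ; _≈_ = _≈_
    ; isEquivalence = record
      { refl  = pointwise λ _ → refl
      ; sym   = λ e → pointwise λ j → sym (at e j)
      ; trans = λ e e′ → pointwise λ j → trans (at e j) (at e′ j)
      }
    }

  ▷-congˡ : ∀ α α′ p → α A.≋ α′ → α ▷ p ≈ α′ ▷ p
  ▷-congˡ _ _ (φ , ps) α≋α′ = pointwise λ j → cong (λ (k , h) → k , h P.▷ ps j) (α≋α′ (φ ⟨$⟩ʳ j))

  ▷-congʳ : ∀ α {p p′} → p ≈ p′ → α ▷ p ≈ α ▷ p′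
  ▷-congʳ (σ , a) p≈p′ = pointwise λ j → cong (λ (k , q) → σ ⟨$⟩ʳ k , a k P.▷ q) (at p≈p′ j)

  ◁-congˡ : ∀ β {p p′} → p ≈ p′ → p ◁ β ≈ p′ ◁ β
  ◁-congˡ (τ , b) p≈p′ = pointwise λ j → cong (λ (k , q) → k , q P.◁ b j) (at p≈p′ (τ ⟨$⟩ʳ j))

  ◁-congʳ : ∀ β β′ p → β B.≋ β′ → p ◁ β ≈ p ◁ β′
  ◁-congʳ _ _ (φ , ps) β≋β′ = pointwise λ j → cong (λ (l , h) → φ ⟨$⟩ʳ l , ps l P.◁ h) (β≋β′ j)

  ▷-ε : ∀ p → A.ε ▷ p ≈ p
  ▷-ε (φ , ps) = pointwise λ j → cong (φ ⟨$⟩ʳ j ,_) (P.▷-id (ps j))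

  ◁-ε : ∀ p → p ◁ B.ε ≈ p
  ◁-ε (φ , ps) = pointwise λ j → cong (φ ⟨$⟩ʳ j ,_) (P.◁-id (ps j))

  ▷-∙ : ∀ α α′ p → (α A.∙ α′) ▷ p ≈ α ▷ α′ ▷ p
  ▷-∙ _ _ _ = pointwise λ j → cong (_ ,_) (P.▷-∘ _ _ _)

  ◁-∙ : ∀ β β′ p → p ◁ (β B.∙ β′) ≈ p ◁ β ◁ β′
  ◁-∙ _ _ _ = pointwise λ j → cong (_ ,_) (P.◁-∘ _ _ _)

  ▷◁-assoc : ∀ α β p → (α ▷ p) ◁ β ≈ α ▷ (p ◁ β)
  ▷◁-assoc _ _ _ = pointwise λ j → cong (_ ,_) (P.▷◁ _ _ _)

  record Stabilises (p : Elem) (α : A.End) (β : B.End) : Set where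
    constructor stabilises
    field stabilised : (α ▷ p) ◁ β ≈ p

  module _ (p : Elem) where
    open SetoidReasoning ≈-setoid

    stabilises-resp : ∀ {α α′ β β′} → α A.≋ α′ → β B.≋ β′ → Stabilises p α β → Stabilises p α′ β′
    stabilises-resp {α} {α′} {β} {β′} α≋α′ β≋β′ (stabilises αpβ≈p) = stabilises $ begin
      (α′ ▷ p) ◁ β′ ≈⟨ ◁-congˡ β′ (▷-congˡ α′ α p (λ i → sym (α≋α′ i))) ⟩
      (α ▷ p) ◁ β′  ≈⟨ ◁-congʳ β′ β (α ▷ p) (λ j → sym (β≋β′ j)) ⟩
      (α ▷ p) ◁ β   ≈⟨ αpβ≈p ⟩
      p             ∎

    stabilises-ε : Stabilises p A.ε B.ε
    stabilises-ε = stabilises $ begin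
      (A.ε ▷ p) ◁ B.ε ≈⟨ ◁-ε (A.ε ▷ p) ⟩
      A.ε ▷ p         ≈⟨ ▷-ε p ⟩
      p               ∎

    stabilises-∙ : ∀ {α₁ β₁ α₂ β₂} → Stabilises p α₁ β₁ → Stabilises p α₂ β₂ →
                   Stabilises p (α₂ A.∙ α₁) (β₁ B.∙ β₂)
    stabilises-∙ {α₁} {β₁} {α₂} {β₂} (stabilises α₁pβ₁≈p) (stabilises α₂pβ₂≈p) = stabilises $ begin
      ((α₂ A.∙ α₁) ▷ p) ◁ (β₁ B.∙ β₂) ≈⟨ ◁-∙ β₁ β₂ ((α₂ A.∙ α₁) ▷ p) ⟩
      ((α₂ A.∙ α₁) ▷ p) ◁ β₁ ◁ β₂     ≈⟨ ◁-congˡ β₂ (◁-congˡ β₁ (▷-∙ α₂ α₁ p)) ⟩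
      (α₂ ▷ α₁ ▷ p) ◁ β₁ ◁ β₂         ≈⟨ ◁-congˡ β₂ (▷◁-assoc α₂ β₁ (α₁ ▷ p)) ⟩
      (α₂ ▷ (α₁ ▷ p) ◁ β₁) ◁ β₂       ≈⟨ ◁-congˡ β₂ (▷-congʳ α₂ α₁pβ₁≈p) ⟩
      (α₂ ▷ p) ◁ β₂                   ≈⟨ α₂pβ₂≈p ⟩
      p                               ∎

    stabilises-inverse : ∀ {α β α′ β′} → Stabilises p α β →
                         α′ A.∙ α A.≋ A.ε → β B.∙ β′ B.≋ B.ε → Stabilises p α′ β′
    stabilises-inverse {α} {β} {α′} {β′} (stabilises αpβ≈p) α′α≋ε ββ′≋ε = stabilises $ begin
      (α′ ▷ p) ◁ β′                 ≈⟨ ◁-congˡ β′ (▷-congʳ α′ αpβ≈p) ⟨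
      (α′ ▷ (α ▷ p) ◁ β) ◁ β′       ≈⟨ ◁-congˡ β′ (▷-congʳ α′ (▷◁-assoc α β p)) ⟩
      (α′ ▷ α ▷ p ◁ β) ◁ β′         ≈⟨ ◁-congˡ β′ (▷-∙ α′ α (p ◁ β)) ⟨
      ((α′ A.∙ α) ▷ p ◁ β) ◁ β′     ≈⟨ ◁-congˡ β′ (▷-congˡ (α′ A.∙ α) A.ε (p ◁ β) α′α≋ε) ⟩
      (A.ε ▷ p ◁ β) ◁ β′            ≈⟨ ◁-congˡ β′ (▷-ε (p ◁ β)) ⟩
      p ◁ β ◁ β′                    ≈⟨ ◁-∙ β β′ p ⟨
      p ◁ (β B.∙ β′)                ≈⟨ ◁-congʳ (β B.∙ β′) B.ε p ββ′≋ε ⟩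
      p ◁ B.ε                       ≈⟨ ◁-ε p ⟩
      p                             ∎

  push : Elem → KA.Subgroup (n , as) → KB.Subgroup (m , bs)
  push p H = record
    { mem  = λ β → Σ A.End λ α → KA.mem H α × Stabilises p α β
    ; resp = λ β≋β′ (α , α∈H , s) → α , α∈H , stabilises-resp p (λ _ → refl) β≋β′ s
    ; id∈  = A.ε , KA.id∈ H , stabilises-ε p
    ; ∘∈   = λ (α₁ , α₁∈H , s₁) (α₂ , α₂∈H , s₂) →
               α₂ A.∙ α₁ , KA.∘∈ H α₂∈H α₁∈H , stabilises-∙ p s₁ s₂
    ; inv∈ = λ {β} (α , α∈H , s) → let (α′ , α′∈H , α′α≋ε , _) = KA.inv∈ H α∈H in
               β B.⁻¹ , (α′ , α′∈H , stabilises-inverse p s α′α≋ε (B.∙⁻¹≋ε β)) ,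
               B.⁻¹∙≋ε β , B.∙⁻¹≋ε β
    }

  pull : Elem → KB.Subgroup (m , bs) → KA.Subgroup (n , as)
  pull p K = record
    { mem  = λ α → Σ B.End λ β → KB.mem K β × Stabilises p α β
    ; resp = λ α≋α′ (β , β∈K , s) → β , β∈K , stabilises-resp p α≋α′ (λ _ → refl) s
    ; id∈  = B.ε , KB.id∈ K , stabilises-ε p
    ; ∘∈   = λ (β₁ , β₁∈K , s₁) (β₂ , β₂∈K , s₂) →
               β₂ B.∙ β₁ , KB.∘∈ K β₂∈K β₁∈K , stabilises-∙ p s₂ s₁
    ; inv∈ = λ {α} (β , β∈K , s) → let (β′ , β′∈K , _ , ββ′≋ε) = KB.inv∈ K β∈K in
               α A.⁻¹ , (β′ , β′∈K , stabilises-inverse p s (A.⁻¹∙≋ε α) ββ′≋ε) ,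
               A.⁻¹∙≋ε α , A.∙⁻¹≋ε α
    }

  ElemAt : Fin m → Set
  ElemAt j = Σ (Fin n) λ k → P.F (lookup bs j) (lookup as k)

  -- walk-act α p t j (l , g) is the j-th component of αᵗ · p · g, for g : b_j → b_l.
  walk-act : A.End → Elem → ∀ t j → B.HomFrom j → ElemAt j
  walk-act (σ , a) (φ , ps) t j (l , g) =
    _^[_]_ 𝔸 σ t (φ ⟨$⟩ʳ l) , (walk 𝔸 {as = as} (σ , a) t (φ ⟨$⟩ʳ l) P.▷ ps l) P.◁ g

  stabilises-walk : ∀ {φ ps σ a τ b} → Stabilises (φ , ps) (σ , a) (τ , b) → ∀ t j →
    walk-act (σ , a) (φ , ps) t j (_^[_]_ 𝔹 τ t j , walk 𝔹 {as = bs} (τ , b) t j) ≡ (φ ⟨$⟩ʳ j , ps j)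
  stabilises-walk {φ} {ps} _ zero j =
    cong (φ ⟨$⟩ʳ j ,_) (P.▷◁-id (ps j))
  stabilises-walk {φ} {ps} {σ} {a} {τ} {b} s@(stabilises αpβ≈p) (suc t) j = begin
    act (suc t) j (_^[_]_ 𝔹 τ (suc t) j , walk 𝔹 {as = bs} (τ , b) (suc t) j)
      ≡⟨ cong (act (suc t) j) (B.walk-suc-shift (τ , b) t j) ⟩
    act (suc t) j (_^[_]_ 𝔹 τ t (τ ⟨$⟩ʳ j) , walk 𝔹 {as = bs} (τ , b) t (τ ⟨$⟩ʳ j) ∘𝔹 b j)
      ≡⟨ cong (_ ,_) (P.▷◁-∘ _ _ _ _ _) ⟩
    step (act t (τ ⟨$⟩ʳ j) (_^[_]_ 𝔹 τ t (τ ⟨$⟩ʳ j) , walk 𝔹 {as = bs} (τ , b) t (τ ⟨$⟩ʳ j)))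
      ≡⟨ cong step (stabilises-walk s t (τ ⟨$⟩ʳ j)) ⟩
    step (φ ⟨$⟩ʳ (τ ⟨$⟩ʳ j) , ps (τ ⟨$⟩ʳ j))
      ≡⟨ at αpβ≈p j ⟩
    (φ ⟨$⟩ʳ j , ps j) ∎
    where
      open ≡-Reasoning
      act : ∀ t j → B.HomFrom j → ElemAt j
      act = walk-act (σ , a) (φ , ps)

      step : ElemAt (τ ⟨$⟩ʳ j) → ElemAt j
      step (k , q) = σ ⟨$⟩ʳ k , (a k P.▷ q) P.◁ b j

  stabilises-cycle : ∀ {φ ps σ a τ b} → Stabilises (φ , ps) (σ , a) (τ , b) →
    ∀ j k (o : IsOrbitLength 𝔹 τ j k) → Σ (IsOrbitLength 𝔸 σ (φ ⟨$⟩ʳ j) k) λ o′ →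
    (cycleEnd 𝔸 {as = as} (σ , a) (φ ⟨$⟩ʳ j) k (proj₁ (proj₂ o′)) P.▷ ps j)
      P.◁ cycleEnd 𝔹 {as = bs} (τ , b) j k (proj₁ (proj₂ o)) ≡ ps j
  stabilises-cycle {φ} {ps} {σ} {a} {τ} {b} s j k (0<k , τᵏj≡j , τ-minimal) =
    (0<k , σᵏφj≡φj , σ-minimal) , ,-injectiveʳ-Fin cycle-stable
    where
      walkα : Groupoid.Hom 𝔸 (lookup as (φ ⟨$⟩ʳ j)) (lookup as (_^[_]_ 𝔸 σ k (φ ⟨$⟩ʳ j)))
      walkα = walk 𝔸 {as = as} (σ , a) k (φ ⟨$⟩ʳ j)
      cycleβ : Groupoid.End 𝔹 (lookup bs j)
      cycleβ = cycleEnd 𝔹 {as = bs} (τ , b) j k τᵏj≡j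

      walk-stable : (ElemAt j ∋ (_^[_]_ 𝔸 σ k (φ ⟨$⟩ʳ j) , (walkα P.▷ ps j) P.◁ cycleβ))
                    ≡ (φ ⟨$⟩ʳ j , ps j)
      walk-stable = trans (cong (walk-act (σ , a) (φ , ps) k j) (sym (,-subst _ τᵏj≡j _)))
                          (stabilises-walk s k j)

      σᵏφj≡φj : _^[_]_ 𝔸 σ k (φ ⟨$⟩ʳ j) ≡ φ ⟨$⟩ʳ j
      σᵏφj≡φj = cong proj₁ walk-stable

      cycle-stable : (ElemAt j ∋ (φ ⟨$⟩ʳ j ,
                        (cycleEnd 𝔸 {as = as} (σ , a) (φ ⟨$⟩ʳ j) k σᵏφj≡φj P.▷ ps j) P.◁ cycleβ))
                     ≡ (φ ⟨$⟩ʳ j , ps j)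
      cycle-stable =
        trans (sym (cong (λ (l , f) → l , (f P.▷ ps j) P.◁ cycleβ) (,-subst _ σᵏφj≡φj walkα)))
              walk-stable

      σ-minimal : ∀ l → 0 < l → l < k → _^[_]_ 𝔸 σ l (φ ⟨$⟩ʳ j) ≢ φ ⟨$⟩ʳ j
      σ-minimal l 0<l l<k σˡφj≡φj = τ-minimal l 0<l l<k
        (⟨$⟩ʳ-injective φ (^[]-injective 𝔸 σ l
          (trans (cong proj₁ (stabilises-walk s l j)) (sym σˡφj≡φj))))

module Lifting {𝔸 𝔹 : Groupoid}
    (𝒜 : KitNotions.SubgroupFamily (Groupoid.raw 𝔸))
    (ℬ : KitNotions.SubgroupFamily (Groupoid.raw 𝔹))
    (𝒜-boolean : IsBooleanKit 𝔸 𝒜) (P : Profunctor 𝔸 𝔹)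
    (P-stable : IsStabilized (Groupoid.raw 𝔸) (Groupoid.raw 𝔹) 𝒜 ℬ (Profunctor.raw P))
    {n : ℕ} (as : Vec (Groupoid.Obj 𝔸) n) {m : ℕ} (bs : Vec (Groupoid.Obj 𝔹) m) where
  private
    module A = SymEnd 𝔸 as
    module B = SymEnd 𝔹 bs
    module KA = KitNotions (Sym 𝔸)
    module KB = KitNotions (Sym 𝔹)
    module L𝔸 = KitProperties (Groupoid.raw 𝔸)
    module LA = KitProperties (Sym 𝔸)
    module LB = KitProperties (Sym 𝔹)
  open SymAction P as bs public

  𝒜^Sym : KA.SubgroupFamily
  𝒜^Sym = _^Sym 𝔸 𝒜

  ℬ^Sym : KB.SubgroupFamily
  ℬ^Sym = _^Sym 𝔹 ℬ

  stabilises-cyclesIn : ∀ {p α β} → Stabilises p α β → A.CyclesIn 𝒜 α → B.CyclesIn ℬ β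
  stabilises-cyclesIn {φ , ps} s α-cycles j k o =
    let (o′ , cycle-stable) = stabilises-cycle s j k o in
    proj₁ (P-stable (ps j) _ _ cycle-stable) (α-cycles (φ ⟨$⟩ʳ j) k o′)

  ε-cyclesIn : A.CyclesIn 𝒜 A.ε
  ε-cyclesIn i k o = subst (KitNotions.⋃ (Groupoid.raw 𝔸) 𝒜 (lookup as i))
                           (sym (A.cycleEnd-ε i k (proj₁ (proj₂ o))))
                           (GroupoidKit.id∈⋃-boolean 𝔸 𝒜-boolean)

  stabilises-ε⇒≋ε : ∀ {p δ} → Stabilises p δ B.ε → A.CyclesIn 𝒜 δ → δ A.≋ A.ε
  stabilises-ε⇒≋ε {φ , ps} {σ , d} s δ-cycles i =
    subst (λ i → (A.HomFrom i ∋ (σ ⟨$⟩ʳ i , d i)) ≡ (i , Groupoid.id 𝔸))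
          (⟨$⟩ʳ∘⟨$⟩ˡ φ) (at-φ (φ ⟨$⟩ˡ i))
    where
      at-φ : ∀ j → (A.HomFrom (φ ⟨$⟩ʳ j) ∋ (σ ⟨$⟩ʳ (φ ⟨$⟩ʳ j) , d (φ ⟨$⟩ʳ j)))
                   ≡ (φ ⟨$⟩ʳ j , Groupoid.id 𝔸)
      at-φ j =
        let (o′ , cycle-stable) = stabilises-cycle s j 1 (B.ε-orbitLength j)
            cycle∈⋃𝒜⊥ = proj₂ (P-stable (ps j) _ _ cycle-stable)
                          (GroupoidKit.≈id⇒∈⋃^⊥ 𝔹 ℬ (B.cycleEnd-ε j 1 refl))
        in trans (A.cycleEnd-1 (σ , d) (φ ⟨$⟩ʳ j) (proj₁ (proj₂ o′)))
                 (cong (_ ,_) (L𝔸.⋃-⋃^⊥⇒≈id 𝒜 (δ-cycles (φ ⟨$⟩ʳ j) 1 o′) cycle∈⋃𝒜⊥))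

  push-^Sym : ∀ p L → 𝒜^Sym (n , as) L → ℬ^Sym (m , bs) (push p L)
  push-^Sym p L L∈ β (α , α∈L , s) = stabilises-cyclesIn s (L∈ α α∈L)

  push-trivial-^Sym : ∀ p → ℬ^Sym (m , bs) (push p A.trivial)
  push-trivial-^Sym p β (α , α≋ε , s) =
    stabilises-cyclesIn (stabilises-resp p α≋ε (λ _ → refl) s) ε-cyclesIn

  pull-^Sym⊥ : ∀ p K → (ℬ^Sym KB.^⊥) (m , bs) K → (𝒜^Sym KA.^⊥) (n , as) (pull p K)
  pull-^Sym⊥ p K K∈ L L∈ α (β , β∈K , s) α∈L =
    stabilises-ε⇒≋ε (stabilises-resp p (λ _ → refl) β≋ε s) (L∈ α α∈L)
    where
      β≋ε : β B.≋ B.ε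
      β≋ε = K∈ (push p L) (push-^Sym p L L∈) β β∈K (α , α∈L , s)

  push-!kit : ∀ p H → !kit 𝔸 𝒜 (n , as) H → !kit 𝔹 ℬ (m , bs) (push p H)
  push-!kit p H H∈ K K∈ β (α , α∈H , s) β∈K =
    K∈ (push p A.trivial) (push-trivial-^Sym p) β β∈K (α , α≋ε , s)
    where
      α≋ε : α A.≋ A.ε
      α≋ε = H∈ (pull p K) (pull-^Sym⊥ p K K∈) α α∈H (β , β∈K , s)

  pull-!kit⊥ : ∀ p K → (!kit 𝔹 ℬ KB.^⊥) (m , bs) K → (!kit 𝔸 𝒜 KA.^⊥) (n , as) (pull p K)
  pull-!kit⊥ p K K∈ =
    LA.⊆^⊥⊥ (𝒜^Sym KA.^⊥) {H = pull p K} (pull-^Sym⊥ p K (LB.^⊥⊥⊥⇒^⊥ ℬ^Sym {H = K} K∈))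

proposition6p5 : (𝔸 𝔹 : Groupoid) (𝒜 : KitNotions.SubgroupFamily (Groupoid.raw 𝔸))
    (ℬ : KitNotions.SubgroupFamily (Groupoid.raw 𝔹)) →
    IsBooleanKit 𝔸 𝒜 → IsBooleanKit 𝔹 ℬ →
    (P : Profunctor 𝔸 𝔹) →
    IsStabilized (Groupoid.raw 𝔸) (Groupoid.raw 𝔹) 𝒜 ℬ (Profunctor.raw P) →
    IsStabilized (Sym 𝔸) (Sym 𝔹) (!kit 𝔸 𝒜) (!kit 𝔹 ℬ) (SymP P)
proposition6p5 𝔸 𝔹 𝒜 ℬ 𝒜-boolean _ P P-stable {_ , as} {_ , bs} p α β αpβ≈p =
    (λ (H , H∈ , α∈H) → push p H , push-!kit p H H∈ , α , α∈H , s)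
  , (λ (K , K∈ , β∈K) → pull p K , pull-!kit⊥ p K K∈ , β , β∈K , s)
  where
    open Lifting 𝒜 ℬ 𝒜-boolean P P-stable as bs
    s : Stabilises p α β
    s = stabilises (pointwise αpβ≈p)
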